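{- There is no $(r\times c, v)$-near triple array for any of the following parameter sets: (a) $((2k-1)\times(4k-3),\ 4k-1)$ for integers $k\geq 3$; (b) $(2k\times(4k-3),\ 4k-1)$ for integers $k\geq 3$; (c) $(k\times(\binom{k}{2}-s),\ \binom{k}{2}+1)$ for positive integers $k,s$ with $1\le s\le \frac{(k-1)(k-2)}{2k}$.
   Context: An $r\times c$ row-column design on $v$ symbols is an $r\times c$ array each of whose cells is filled with one of $v$ symbols. It is binary if no symbol occurs more than once in any row or in any column. Let $e=rc/v$, $e^-=\lfloor e\rfloor$, $e^+=\lceil e\rceil$. The design is equireplicate if $e$ is an integer and every symbol occurs exactly $e$ times, and near equireplicate if $e$ is not an integer and every symbol occurs $e^-$ or $e^+$ times. For a binary design, let $R_i$, $C_j$ be the symbol sets of row $i$ and column $j$, and put $\lambda_{rc}=\frac{1}{rc}\sum_{i,j}|R_i\cap C_j|$, $\lambda_{rr}=\binom{r}{2}^{ -1}\sum_{i<j}|R_i\cap R_j|$, $\lambda_{cc}=\binom{c}{2}^{ -1}\sum_{i<j}|C_i\cap C_j|$; for real $x$, $x^-=\lfloor x\rfloor$, $x^+=\lceil x\rceil$. An $(r\times c,v)$-near triple array is a binary $r\times c$ row-column design on $v$ symbols which is equireplicate or near equireplicate and in which every row and column share $\lambda_{rc}^-$ or $\lambda_{rc}^+$ symbols, every two distinct rows share $\lambda_{rr}^-$ or $\lambda_{rr}^+$ symbols, and every two distinct columns share $\lambda_{cc}^-$ or $\lambda_{cc}^+$ symbols. -}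

module Defs where

open import Data.Nat using (ℕ; zero; suc; _+_; _*_; _∸_; _<_; _<ᵇ_)
open import Data.Nat.DivMod using (_/_)
open import Data.Nat.Divisibility using (_∣_)
open import Data.Nat.Combinatorics using (_C_)
open import Data.Fin using (Fin; toℕ; _≟_)
open import Data.List using (List; map; allFin)
open import Data.Nat.ListAction using (sum)
open import Data.Bool.ListAction using (any)
open import Data.Bool using (Bool; true; false; if_then_else_; _∧_)
open import Data.Product using (_×_)
open import Data.Sum using (_⊎_)
open import Relation.Nullary using (¬_; does)
open import Relation.Binary.PropositionalEquality using (_≡_)

Design : ℕ → ℕ → ℕ → Set
Design r c v = Fin r → Fin c → Fin v

-- floor and ceiling of m / n (only used with n ≠ 0 in a meaningful way;
-- for n = 0 the corresponding condition ranges over an empty set)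
⌊_/_⌋ : ℕ → ℕ → ℕ
⌊ m / zero ⌋ = 0
⌊ m / suc n ⌋ = m / suc n

⌈_/_⌉ : ℕ → ℕ → ℕ
⌈ m / zero ⌉ = 0
⌈ m / suc n ⌉ = (m + n) / suc n

FloorOrCeil : ℕ → ℕ → ℕ → Set
FloorOrCeil m n x = (x ≡ ⌊ m / n ⌋) ⊎ (x ≡ ⌈ m / n ⌉)

Σ[_] : (n : ℕ) → (Fin n → ℕ) → ℕ
Σ[ n ] f = sum (map f (allFin n))

count : (n : ℕ) → (Fin n → Bool) → ℕ
count n p = Σ[ n ] (λ i → if p i then 1 else 0)

module _ {r c v : ℕ} (A : Design r c v) where

  Binary : Set
  Binary = (∀ i j j′ → A i j ≡ A i j′ → j ≡ j′)
         × (∀ i i′ j → A i j ≡ A i′ j → i ≡ i′)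

  rep : Fin v → ℕ
  rep x = Σ[ r ] (λ i → count c (λ j → does (A i j ≟ x)))

  EquiOrNearEqui : Set
  EquiOrNearEqui =
      (v ∣ r * c × (∀ x → rep x ≡ ⌊ r * c / v ⌋))
    ⊎ (¬ (v ∣ r * c) × (∀ x → FloorOrCeil (r * c) v (rep x)))

  inRow : Fin r → Fin v → Bool
  inRow i x = any (λ j → does (A i j ≟ x)) (allFin c)

  inCol : Fin c → Fin v → Bool
  inCol j x = any (λ i → does (A i j ≟ x)) (allFin r)

  rowCol : Fin r → Fin c → ℕ
  rowCol i j = count v (λ x → inRow i x ∧ inCol j x)

  rowRow : Fin r → Fin r → ℕ
  rowRow i i′ = count v (λ x → inRow i x ∧ inRow i′ x)

  colCol : Fin c → Fin c → ℕ
  colCol j j′ = count v (λ x → inCol j x ∧ inCol j′ x)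

  -- numerators of λ_rc, λ_rr, λ_cc (denominators rc, binom r 2, binom c 2)
  Src : ℕ
  Src = Σ[ r ] (λ i → Σ[ c ] (λ j → rowCol i j))

  Srr : ℕ
  Srr = Σ[ r ] (λ i → Σ[ r ] (λ i′ → if toℕ i <ᵇ toℕ i′ then rowRow i i′ else 0))

  Scc : ℕ
  Scc = Σ[ c ] (λ j → Σ[ c ] (λ j′ → if toℕ j <ᵇ toℕ j′ then colCol j j′ else 0))

  IsNearTripleArray : Set
  IsNearTripleArray =
      Binary
    × EquiOrNearEqui
    × (∀ i j → FloorOrCeil Src (r * c) (rowCol i j))
    × (∀ i i′ → toℕ i < toℕ i′ → FloorOrCeil Srr (r C 2) (rowRow i i′))
    × (∀ j j′ → toℕ j < toℕ j′ → FloorOrCeil Scc (c C 2) (colCol j j′))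

NearTripleArray : ℕ → ℕ → ℕ → Set
NearTripleArray r c v = Σ (Design r c v) IsNearTripleArray
  where open import Data.Product using (Σ)

{-# OPTIONS --safe #-}
module Submission where

-- Let N be the c × v incidence matrix of columns against symbols: N Nᵀ counts
-- column intersections (diagonal r) and Nᵀ N counts the columns shared by two
-- symbols (diagonal: the replication numbers).  The squares of the two Gram
-- matrices have the same trace.  The off-diagonal entries of N Nᵀ take only the
-- values m and m + 1, where m = ⌊λcc⌋, so x² + m(m + 1) = (2m + 1)x holds on
-- them exactly, while for an arbitrary natural x only ≥ holds.  Comparing the
-- traces gives 2m(cr² − Q) ≤ m(m + 1)(v − c)(v + c − 1), where Q = Σₓ rep(x)²
-- is pinned down by the (near) equireplication, and the intersection counts
-- give c(c − 1)m ≤ Q − cr ≤ c(c − 1)(m + 1).  For each of the three parameter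
-- families these counts force 1 ≤ m ≤ M for an explicit M, and the trace
-- inequality then fails.

open import Data.Bool using (Bool; true; false; if_then_else_; _∧_; T)
open import Data.Bool.ListAction using (or)
open import Data.Bool.Properties using (T-≡)
open import Data.Fin using (Fin; zero; suc; toℕ; punchIn; _≟_)
open import Data.Fin.Properties using (punchInᵢ≢i; 0≢1+n; suc-injective; toℕ-injective)
open import Data.List using ([]; _∷_; tabulate)
open import Data.List.Properties using (map-tabulate)
open import Data.Nat using (ℕ; zero; suc; _+_; _*_; _∸_; _≤_; _<_; z≤n; s≤s)
open import Data.Nat.Combinatorics using (_C_; nC1≡n; nCk+nC[k+1]≡[n+1]C[k+1])
open import Data.Nat.DivMod using (_/_; /-monoˡ-≤; m/n≡1+[m∸n]/n; m*n/n≡m; m<n*o⇒m/o<n)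
open import Data.Nat.ListAction using () renaming (sum to sumˡ)
open import Data.Nat.Properties hiding (suc-injective; _≟_; 0≢1+n)
open import Data.Nat.Tactic.RingSolver using (solve)
open import Data.Product using (_×_; _,_)
open import Data.Sum using (_⊎_; inj₁; inj₂)
open import Function using (id; _∘_; flip)
open import Function.Bundles using (Equivalence)
open import Relation.Binary.Definitions using (tri<; tri≈; tri>)
open import Relation.Binary.PropositionalEquality
open import Relation.Nullary using (¬_; does; yes; no; contradiction)
open import Relation.Nullary.Decidable using (dec-true; dec-false)

open import Algebra.Properties.CommutativeSemigroup +-commutativeSemigroup using (xy∙z≈xz∙y)
open import Algebra.Properties.CommutativeSemigroup *-commutativeSemigroup
  using () renaming (interchange to *-interchange)
open import Algebra.Properties.Semiring.Sum +-*-semiring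
  using (sum; sum-syntax; sum-cong-≗; sum-remove; ∑-comm; ∑-distrib-+; *-distribˡ-sum; *-distribʳ-sum)

open import Defs

∑-tabulate : ∀ {n} (f : Fin n → ℕ) → sumˡ (tabulate f) ≡ sum f
∑-tabulate {zero}  f = refl
∑-tabulate {suc n} f = cong (f zero +_) (∑-tabulate (f ∘ suc))

Σ[]≡∑ : ∀ n (f : Fin n → ℕ) → Σ[ n ] f ≡ sum f
Σ[]≡∑ n f = trans (cong sumˡ (map-tabulate id f)) (∑-tabulate f)

∑-const : ∀ n k → ∑[ i < n ] k ≡ n * k
∑-const zero    k = refl
∑-const (suc n) k = cong (k +_) (∑-const n k)

∑-+-const : ∀ {n} (f : Fin n → ℕ) k → ∑[ i < n ] (f i + k) ≡ sum f + n * k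
∑-+-const {n} f k = trans (∑-distrib-+ f (λ _ → k)) (cong (sum f +_) (∑-const n k))

∑∑-const : ∀ m n k → ∑[ i < m ] ∑[ j < n ] k ≡ m * (n * k)
∑∑-const m n k = trans (sum-cong-≗ {m} λ _ → ∑-const n k) (∑-const m (n * k))

∑∑-+-const : ∀ {m n} (f : Fin m → Fin n → ℕ) k →
  ∑[ i < m ] ∑[ j < n ] (f i j + k) ≡ ∑[ i < m ] sum (f i) + m * (n * k)
∑∑-+-const {m} {n} f k = trans (sum-cong-≗ λ i → ∑-+-const (f i) k) (∑-+-const (sum ∘ f) (n * k))

∑∑-*ˡ : ∀ {m n} k (f : Fin m → Fin n → ℕ) → k * ∑[ i < m ] sum (f i) ≡ ∑[ i < m ] ∑[ j < n ] (k * f i j)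
∑∑-*ˡ k f = trans (*-distribˡ-sum k (sum ∘ f)) (sum-cong-≗ λ i → *-distribˡ-sum k (f i))

∑-mono-≤ : ∀ {n} {f g : Fin n → ℕ} → (∀ i → f i ≤ g i) → sum f ≤ sum g
∑-mono-≤ {zero}  f≤g = z≤n
∑-mono-≤ {suc n} f≤g = +-mono-≤ (f≤g zero) (∑-mono-≤ (f≤g ∘ suc))

∑*∑ : ∀ {m n} (f : Fin m → ℕ) (g : Fin n → ℕ) → sum f * sum g ≡ ∑[ i < m ] ∑[ j < n ] (f i * g j)
∑*∑ f g = trans (*-distribʳ-sum (sum g) f) (sum-cong-≗ λ i → *-distribˡ-sum (f i) g)

∑-comm₃ : ∀ {l m n} (f : Fin l → Fin m → Fin n → ℕ) →
  ∑[ i < l ] ∑[ j < m ] ∑[ k < n ] f i j k ≡ ∑[ j < m ] ∑[ k < n ] ∑[ i < l ] f i j k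
∑-comm₃ f = trans (∑-comm λ i j → sum (f i j)) (sum-cong-≗ λ j → ∑-comm λ i k → f i j k)

∑-≤-except : ∀ {n} (i : Fin (suc n)) {f g : Fin (suc n) → ℕ} {a b : ℕ} →
  (∀ j → j ≢ i → f j ≤ g j) → f i + a ≤ g i + b → sum f + a ≤ sum g + b
∑-≤-except {n} i {f} {g} {a} {b} off diag = begin
  sum f + a                             ≡⟨ cong (_+ a) (sum-remove f) ⟩
  f i + ∑[ j < n ] f (punchIn i j) + a  ≡⟨ xy∙z≈xz∙y (f i) _ a ⟩
  f i + a + ∑[ j < n ] f (punchIn i j)  ≤⟨ +-mono-≤ diag (∑-mono-≤ λ j → off (punchIn i j) (punchInᵢ≢i i j)) ⟩
  g i + b + ∑[ j < n ] g (punchIn i j)  ≡⟨ xy∙z≈xz∙y (g i) _ b ⟨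
  g i + ∑[ j < n ] g (punchIn i j) + b  ≡⟨ cong (_+ b) (sum-remove g) ⟨
  sum g + b                             ∎
  where open ≤-Reasoning

∑∑-≤-offDiagonal : ∀ {n} {f g : Fin n → Fin n → ℕ} {a b : Fin n → ℕ} →
  (∀ i j → j ≢ i → f i j ≤ g i j) → (∀ i → f i i + a i ≤ g i i + b i) →
  ∑[ i < n ] sum (f i) + sum a ≤ ∑[ i < n ] sum (g i) + sum b
∑∑-≤-offDiagonal {zero}                  off diag = z≤n
∑∑-≤-offDiagonal {suc n} {f} {g} {a} {b} off diag = begin
  ∑[ i < suc n ] sum (f i) + sum a    ≡⟨ ∑-distrib-+ (sum ∘ f) a ⟨
  ∑[ i < suc n ] (sum (f i) + a i)    ≤⟨ ∑-mono-≤ (λ i → ∑-≤-except i (off i) (diag i)) ⟩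
  ∑[ i < suc n ] (sum (g i) + b i)    ≡⟨ ∑-distrib-+ (sum ∘ g) b ⟩
  ∑[ i < suc n ] sum (g i) + sum b    ∎
  where open ≤-Reasoning

gram : ∀ {m n} → (Fin m → Fin n → ℕ) → Fin m → Fin m → ℕ
gram {n = n} a i i′ = ∑[ k < n ] (a i k * a i′ k)

module _ {m n} (a : Fin m → Fin n → ℕ) where

  gram-diag : ∀ i → (∀ k → a i k * a i k ≡ a i k) → gram a i i ≡ ∑[ k < n ] a i k
  gram-diag i idem = sum-cong-≗ idem

  gram-sym : ∀ i i′ → gram a i i′ ≡ gram a i′ i
  gram-sym i i′ = sum-cong-≗ λ k → *-comm (a i k) (a i′ k)

  ∑∑-gram : ∑[ i < m ] ∑[ i′ < m ] gram a i i′ ≡ ∑[ k < n ] (∑[ i < m ] a i k * ∑[ i < m ] a i k)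
  ∑∑-gram = trans (sym (∑-comm₃ λ k i i′ → a i k * a i′ k)) (sum-cong-≗ λ k → sym (∑*∑ (flip a k) (flip a k)))

  ∑∑-gram² : ∑[ i < m ] ∑[ i′ < m ] (gram a i i′ * gram a i i′)
           ≡ ∑[ k < n ] ∑[ l < n ] (gram (flip a) k l * gram (flip a) k l)
  ∑∑-gram² = begin
    ∑[ i < m ] ∑[ i′ < m ] (gram a i i′ * gram a i i′)
      ≡⟨ sum-cong-≗ (λ i → sum-cong-≗ λ i′ → ∑*∑ (λ k → a i k * a i′ k) (λ l → a i l * a i′ l)) ⟩
    ∑[ i < m ] ∑[ i′ < m ] ∑[ k < n ] ∑[ l < n ] ((a i k * a i′ k) * (a i l * a i′ l))
      ≡⟨ sum-cong-≗ (λ i → ∑-comm₃ λ i′ k l → (a i k * a i′ k) * (a i l * a i′ l)) ⟩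
    ∑[ i < m ] ∑[ k < n ] ∑[ l < n ] ∑[ i′ < m ] ((a i k * a i′ k) * (a i l * a i′ l))
      ≡⟨ ∑-comm₃ (λ i k l → ∑[ i′ < m ] ((a i k * a i′ k) * (a i l * a i′ l))) ⟩
    ∑[ k < n ] ∑[ l < n ] ∑[ i < m ] ∑[ i′ < m ] ((a i k * a i′ k) * (a i l * a i′ l))
      ≡⟨ sum-cong-≗ (λ k → sum-cong-≗ λ l → sum-cong-≗ λ i → sum-cong-≗ λ i′ → *-interchange (a i k) (a i′ k) (a i l) (a i′ l)) ⟩
    ∑[ k < n ] ∑[ l < n ] ∑[ i < m ] ∑[ i′ < m ] ((a i k * a i l) * (a i′ k * a i′ l))
      ≡⟨ sum-cong-≗ (λ k → sum-cong-≗ λ l → ∑*∑ (λ i → a i k * a i l) (λ i′ → a i′ k * a i′ l)) ⟨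
    ∑[ k < n ] ∑[ l < n ] (gram (flip a) k l * gram (flip a) k l)   ∎
    where open ≡-Reasoning

m+k≡n⇒m≤n : ∀ {m n} k → m + k ≡ n → m ≤ n
m+k≡n⇒m≤n k refl = m≤m+n _ k

m+k≡n⇒m<n : ∀ {m n} k → 0 < k → m + k ≡ n → m < n
m+k≡n⇒m<n {m} (suc k) _ m+k≡n = m+k≡n⇒m≤n k (trans (sym (+-suc m k)) m+k≡n)

pair-identity : ∀ m {x} → x ≡ m ⊎ x ≡ suc m → x * x + m * suc m ≡ suc (2 * m) * x
pair-identity m (inj₁ refl) = solve (m ∷ [])
pair-identity m (inj₂ refl) = solve (m ∷ [])

pair-inequality : ∀ m x → suc (2 * m) * x ≤ x * x + m * suc m
pair-inequality m x with ≤-<-connex x m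
... | inj₁ x≤m with m≤n⇒∃[o]m+o≡n x≤m
...   | d , refl = m+k≡n⇒m≤n (d * suc d) (solve (x ∷ d ∷ []))
pair-inequality m x | inj₂ m<x with m≤n⇒∃[o]m+o≡n m<x
...   | d , refl = m+k≡n⇒m≤n (d * suc d) (solve (m ∷ d ∷ []))

∑∑-squares-≥ : ∀ {n} (X : Fin n → Fin n → ℕ) m →
  suc (2 * m) * ∑[ i < n ] sum (X i) + (∑[ i < n ] (X i i * X i i) + n * (m * suc m))
    ≤ ∑[ i < n ] ∑[ j < n ] (X i j * X i j) + n * (n * (m * suc m)) + suc (2 * m) * ∑[ i < n ] X i i
∑∑-squares-≥ {n} X m = subst₂ _≤_
  (cong₂ _+_ (sym (∑∑-*ˡ K X)) (∑-+-const (λ i → X i i * X i i) P))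
  (cong₂ _+_ (∑∑-+-const (λ i j → X i j * X i j) P) (sym (*-distribˡ-sum K (λ i → X i i))))
  (∑∑-≤-offDiagonal (λ i j _ → pair-inequality m (X i j)) (λ i → ≤-reflexive (+-comm (K * X i i) _)))
  where
  K P : ℕ
  K = suc (2 * m)
  P = m * suc m

module TwoValuedOffDiagonal {n} (X : Fin n → Fin n → ℕ) (m : ℕ)
  (two-valued : ∀ i j → j ≢ i → X i j ≡ m ⊎ X i j ≡ suc m) where

  private
    m≤X : ∀ i j → j ≢ i → m ≤ X i j
    m≤X i j j≢i with two-valued i j j≢i
    ... | inj₁ X≡m  = ≤-reflexive (sym X≡m)
    ... | inj₂ X≡1+m = ≤-trans (n≤1+n m) (≤-reflexive (sym X≡1+m))

    X≤1+m : ∀ i j → j ≢ i → X i j ≤ suc m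
    X≤1+m i j j≢i with two-valued i j j≢i
    ... | inj₁ X≡m  = ≤-trans (≤-reflexive X≡m) (n≤1+n m)
    ... | inj₂ X≡1+m = ≤-reflexive X≡1+m

  ∑∑-lower : n * (n * m) + ∑[ i < n ] X i i ≤ ∑[ i < n ] sum (X i) + n * m
  ∑∑-lower = subst₂ _≤_ (cong (_+ _) (∑∑-const n n m)) (cong (_ +_) (∑-const n m))
    (∑∑-≤-offDiagonal m≤X (λ i → ≤-reflexive (+-comm m (X i i))))

  ∑∑-upper : ∑[ i < n ] sum (X i) + n * suc m ≤ n * (n * suc m) + ∑[ i < n ] X i i
  ∑∑-upper = subst₂ _≤_ (cong (_ +_) (∑-const n (suc m))) (cong (_+ _) (∑∑-const n n (suc m)))
    (∑∑-≤-offDiagonal X≤1+m (λ i → ≤-reflexive (+-comm (X i i) (suc m))))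

  ∑∑-squares-≤ : ∑[ i < n ] ∑[ j < n ] (X i j * X i j) + n * (n * (m * suc m)) + suc (2 * m) * ∑[ i < n ] X i i
               ≤ suc (2 * m) * ∑[ i < n ] sum (X i) + (∑[ i < n ] (X i i * X i i) + n * (m * suc m))
  ∑∑-squares-≤ = subst₂ _≤_
    (cong₂ _+_ (∑∑-+-const (λ i j → X i j * X i j) P) (sym (*-distribˡ-sum K (λ i → X i i))))
    (cong₂ _+_ (sym (∑∑-*ˡ K X)) (∑-+-const (λ i → X i i * X i i) P))
    (∑∑-≤-offDiagonal (λ i j j≢i → ≤-reflexive (pair-identity m (two-valued i j j≢i)))
                      (λ i → ≤-reflexive (+-comm _ (K * X i i))))
    where
    K P : ℕ
    K = suc (2 * m)
    P = m * suc m

trace-comparison : ∀ {c v r Q S m} →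
  S + c * (c * (m * suc m)) + suc (2 * m) * (c * r) ≤ suc (2 * m) * Q + (c * (r * r) + c * (m * suc m)) →
  suc (2 * m) * (c * (r * r)) + (Q + v * (m * suc m)) ≤ S + v * (v * (m * suc m)) + suc (2 * m) * (c * r) →
  m * (2 * (c * (r * r)) + suc m * (c * c + v)) ≤ m * (2 * Q + suc m * (v * v + c))
trace-comparison {c} {v} {r} {Q} {S} {m} columns symbols = +-cancelʳ-≤ (S + suc (2 * m) * (c * r) + c * (r * r) + Q) _ _ (begin
  m * (2 * (c * (r * r)) + suc m * (c * c + v)) + (S + suc (2 * m) * (c * r) + c * (r * r) + Q)
    ≡⟨ solve (c ∷ v ∷ r ∷ Q ∷ S ∷ m ∷ []) ⟩
  (S + c * (c * (m * suc m)) + suc (2 * m) * (c * r)) + (suc (2 * m) * (c * (r * r)) + (Q + v * (m * suc m)))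
    ≤⟨ +-mono-≤ columns symbols ⟩
  (suc (2 * m) * Q + (c * (r * r) + c * (m * suc m))) + (S + v * (v * (m * suc m)) + suc (2 * m) * (c * r))
    ≡⟨ solve (c ∷ v ∷ r ∷ Q ∷ S ∷ m ∷ []) ⟩
  m * (2 * Q + suc m * (v * v + c)) + (S + suc (2 * m) * (c * r) + c * (r * r) + Q) ∎)
  where open ≤-Reasoning

⟦_⟧ : Bool → ℕ
⟦ b ⟧ = if b then 1 else 0

⟦∧⟧ : ∀ a b → ⟦ a ∧ b ⟧ ≡ ⟦ a ⟧ * ⟦ b ⟧
⟦∧⟧ true  true  = refl
⟦∧⟧ true  false = refl
⟦∧⟧ false b     = refl

⟦⟧-idem : ∀ b → ⟦ b ⟧ * ⟦ b ⟧ ≡ ⟦ b ⟧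
⟦⟧-idem true  = refl
⟦⟧-idem false = refl

⟦or⟧≡∑ : ∀ {n} (p : Fin n → Bool) → (∀ i j → T (p i) → T (p j) → i ≡ j) →
  ⟦ or (tabulate p) ⟧ ≡ ∑[ i < n ] ⟦ p i ⟧
⟦or⟧≡∑ {zero}  p unique = refl
⟦or⟧≡∑ {suc n} p unique with p zero in p₀
... | false = ⟦or⟧≡∑ (p ∘ suc) λ i j pᵢ pⱼ → suc-injective (unique (suc i) (suc j) pᵢ pⱼ)
... | true  = cong suc (sym (trans (sum-cong-≗ others-false) (trans (∑-const n 0) (*-zeroʳ n))))
  where
  others-false : ∀ i → ⟦ p (suc i) ⟧ ≡ 0
  others-false i with p (suc i) in pᵢ
  ... | false = refl
  ... | true  = contradiction (unique zero (suc i) (Equivalence.from T-≡ p₀) (Equivalence.from T-≡ pᵢ)) 0≢1+n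

∑-⟦≟⟧ : ∀ {n} (y : Fin n) → ∑[ x < n ] ⟦ does (y ≟ x) ⟧ ≡ 1
∑-⟦≟⟧ {suc n} y = begin
  ∑[ x < suc n ] ⟦ does (y ≟ x) ⟧                            ≡⟨ sum-remove {i = y} (λ x → ⟦ does (y ≟ x) ⟧) ⟩
  ⟦ does (y ≟ y) ⟧ + ∑[ k < n ] ⟦ does (y ≟ punchIn y k) ⟧  ≡⟨ cong₂ _+_ (cong ⟦_⟧ (dec-true (y ≟ y) refl)) (sum-cong-≗ others) ⟩
  1 + ∑[ k < n ] 0                                           ≡⟨ cong suc (trans (∑-const n 0) (*-zeroʳ n)) ⟩
  1                                                          ∎
  where
  open ≡-Reasoning
  others : ∀ k → ⟦ does (y ≟ punchIn y k) ⟧ ≡ 0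
  others k = cong ⟦_⟧ (dec-false (y ≟ punchIn y k) (punchInᵢ≢i y k ∘ sym))

≟-sound : ∀ {n} {y x : Fin n} → T (does (y ≟ x)) → y ≡ x
≟-sound {y = y} {x} t with y ≟ x
... | yes y≡x = y≡x

module Incidence {r c v} (A : Design r c v) (col-binary : ∀ i i′ j → A i j ≡ A i′ j → i ≡ i′) where

  N : Fin c → Fin v → ℕ
  N j x = ⟦ inCol A j x ⟧

  N≡∑ : ∀ j x → N j x ≡ ∑[ i < r ] ⟦ does (A i j ≟ x) ⟧
  N≡∑ j x = trans (cong (λ bs → ⟦ or bs ⟧) (map-tabulate id (λ i → does (A i j ≟ x))))
                  (⟦or⟧≡∑ (λ i → does (A i j ≟ x)) at-most-once)
    where
    at-most-once : ∀ i i′ → T (does (A i j ≟ x)) → T (does (A i′ j ≟ x)) → i ≡ i′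
    at-most-once i i′ p p′ = col-binary i i′ j (trans (≟-sound p) (sym (≟-sound p′)))

  N-idem : ∀ j x → N j x * N j x ≡ N j x
  N-idem j x = ⟦⟧-idem (inCol A j x)

  column-size : ∀ j → ∑[ x < v ] N j x ≡ r
  column-size j = begin
    ∑[ x < v ] N j x                             ≡⟨ sum-cong-≗ (N≡∑ j) ⟩
    ∑[ x < v ] ∑[ i < r ] ⟦ does (A i j ≟ x) ⟧  ≡⟨ ∑-comm (λ x i → ⟦ does (A i j ≟ x) ⟧) ⟩
    ∑[ i < r ] ∑[ x < v ] ⟦ does (A i j ≟ x) ⟧  ≡⟨ sum-cong-≗ (λ i → ∑-⟦≟⟧ (A i j)) ⟩
    ∑[ i < r ] 1                                 ≡⟨ ∑-const r 1 ⟩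
    r * 1                                        ≡⟨ *-identityʳ r ⟩
    r                                            ∎
    where open ≡-Reasoning

  colCol≡gram : ∀ j j′ → colCol A j j′ ≡ gram N j j′
  colCol≡gram j j′ = trans (Σ[]≡∑ v _) (sum-cong-≗ λ x → ⟦∧⟧ (inCol A j x) (inCol A j′ x))

  R : Fin v → ℕ
  R x = ∑[ j < c ] N j x

  ∑R² : ℕ
  ∑R² = ∑[ x < v ] (R x * R x)

  rep≡R : ∀ x → rep A x ≡ R x
  rep≡R x = begin
    rep A x                                      ≡⟨ Σ[]≡∑ r _ ⟩
    ∑[ i < r ] count c (λ j → does (A i j ≟ x))  ≡⟨ sum-cong-≗ (λ i → Σ[]≡∑ c (λ j → ⟦ does (A i j ≟ x) ⟧)) ⟩
    ∑[ i < r ] ∑[ j < c ] ⟦ does (A i j ≟ x) ⟧  ≡⟨ ∑-comm (λ i j → ⟦ does (A i j ≟ x) ⟧) ⟩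
    ∑[ j < c ] ∑[ i < r ] ⟦ does (A i j ≟ x) ⟧  ≡⟨ sum-cong-≗ (λ j → N≡∑ j x) ⟨
    R x                                          ∎
    where open ≡-Reasoning

  ∑R : sum R ≡ c * r
  ∑R = trans (∑-comm (flip N)) (trans (sum-cong-≗ column-size) (∑-const c r))

  gram-N-diag : ∀ j → gram N j j ≡ r
  gram-N-diag j = trans (gram-diag N j (N-idem j)) (column-size j)

  gram-Nᵀ-diag : ∀ x → gram (flip N) x x ≡ R x
  gram-Nᵀ-diag x = gram-diag (flip N) x (λ j → N-idem j x)

  ∑gram-N-diag : ∑[ j < c ] gram N j j ≡ c * r
  ∑gram-N-diag = trans (sum-cong-≗ gram-N-diag) (∑-const c r)

  ∑gram-N-diag² : ∑[ j < c ] (gram N j j * gram N j j) ≡ c * (r * r)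
  ∑gram-N-diag² = trans (sum-cong-≗ λ j → cong₂ _*_ (gram-N-diag j) (gram-N-diag j)) (∑-const c (r * r))

  ∑∑gram-Nᵀ : ∑[ x < v ] sum (gram (flip N) x) ≡ c * (r * r)
  ∑∑gram-Nᵀ = trans (∑∑-gram (flip N)) (trans (sum-cong-≗ λ j → cong₂ _*_ (column-size j) (column-size j)) (∑-const c (r * r)))

  ∑R²-replication : ∀ e → (∀ x → R x ≡ e ⊎ R x ≡ suc e) → ∑R² + v * (e * suc e) ≡ suc (2 * e) * (c * r)
  ∑R²-replication e two-valued = begin
    ∑R² + v * (e * suc e)               ≡⟨ ∑-+-const (λ x → R x * R x) (e * suc e) ⟨
    ∑[ x < v ] (R x * R x + e * suc e)  ≡⟨ sum-cong-≗ (λ x → pair-identity e (two-valued x)) ⟩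
    ∑[ x < v ] (suc (2 * e) * R x)      ≡⟨ *-distribˡ-sum (suc (2 * e)) R ⟨
    suc (2 * e) * sum R                 ≡⟨ cong (suc (2 * e) *_) ∑R ⟩
    suc (2 * e) * (c * r)               ∎
    where open ≡-Reasoning

  module _ (m : ℕ) (two-valued : ∀ j j′ → j′ ≢ j → gram N j j′ ≡ m ⊎ gram N j j′ ≡ suc m) where

    private
      module M = TwoValuedOffDiagonal (gram N) m two-valued

      K P S : ℕ
      K = suc (2 * m)
      P = m * suc m
      S = ∑[ j < c ] ∑[ j′ < c ] (gram N j j′ * gram N j j′)

    intersections-lower : c * (c * m) + c * r ≤ ∑R² + c * m
    intersections-lower = subst₂ (λ a b → c * (c * m) + a ≤ b + c * m) ∑gram-N-diag (∑∑-gram N) M.∑∑-lower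

    intersections-upper : ∑R² + c * suc m ≤ c * (c * suc m) + c * r
    intersections-upper = subst₂ (λ a b → b + c * suc m ≤ c * (c * suc m) + a) ∑gram-N-diag (∑∑-gram N) M.∑∑-upper

    frobenius : m * (2 * (c * (r * r)) + suc m * (c * c + v)) ≤ m * (2 * ∑R² + suc m * (v * v + c))
    frobenius = trace-comparison {c} {v} {r} {∑R²} {S} {m} column-squares symbol-squares
      where
      open ≤-Reasoning

      column-squares : S + c * (c * P) + K * (c * r) ≤ K * ∑R² + (c * (r * r) + c * P)
      column-squares = begin
        S + c * (c * P) + K * (c * r)
          ≡⟨ cong (λ y → S + c * (c * P) + K * y) ∑gram-N-diag ⟨
        S + c * (c * P) + K * ∑[ j < c ] gram N j j
          ≤⟨ M.∑∑-squares-≤ ⟩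
        K * ∑[ j < c ] sum (gram N j) + (∑[ j < c ] (gram N j j * gram N j j) + c * P)
          ≡⟨ cong₂ (λ y z → K * y + (z + c * P)) (∑∑-gram N) ∑gram-N-diag² ⟩
        K * ∑R² + (c * (r * r) + c * P)
          ∎

      symbol-squares : K * (c * (r * r)) + (∑R² + v * P) ≤ S + v * (v * P) + K * (c * r)
      symbol-squares = begin
        K * (c * (r * r)) + (∑R² + v * P)
          ≡⟨ cong₂ (λ y z → K * y + (z + v * P)) ∑∑gram-Nᵀ (sum-cong-≗ λ x → cong₂ _*_ (gram-Nᵀ-diag x) (gram-Nᵀ-diag x)) ⟨
        K * ∑[ x < v ] sum (gram (flip N) x) + (∑[ x < v ] (gram (flip N) x x * gram (flip N) x x) + v * P)
          ≤⟨ ∑∑-squares-≥ (gram (flip N)) m ⟩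
        ∑[ x < v ] ∑[ y < v ] (gram (flip N) x y * gram (flip N) x y) + v * (v * P) + K * ∑[ x < v ] gram (flip N) x x
          ≡⟨ cong₂ (λ y z → y + v * (v * P) + K * z) (sym (∑∑-gram² N)) (trans (sum-cong-≗ gram-Nᵀ-diag) ∑R) ⟩
        S + v * (v * P) + K * (c * r)
          ∎

≤x≤1+⇒≡⊎≡1+ : ∀ {m x} → m ≤ x → x ≤ suc m → x ≡ m ⊎ x ≡ suc m
≤x≤1+⇒≡⊎≡1+ m≤x x≤1+m with m≤n⇒m<n∨m≡n x≤1+m
... | inj₁ (s≤s x≤m) = inj₁ (≤-antisym x≤m m≤x)
... | inj₂ x≡1+m     = inj₂ x≡1+m

⌈/⌉≡⌊/⌋⊎⌈/⌉≡1+⌊/⌋ : ∀ a n → ⌈ a / n ⌉ ≡ ⌊ a / n ⌋ ⊎ ⌈ a / n ⌉ ≡ suc ⌊ a / n ⌋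
⌈/⌉≡⌊/⌋⊎⌈/⌉≡1+⌊/⌋ a zero    = inj₁ refl
⌈/⌉≡⌊/⌋⊎⌈/⌉≡1+⌊/⌋ a (suc n) = ≤x≤1+⇒≡⊎≡1+ (/-monoˡ-≤ (suc n) (m≤m+n a n)) (begin
  (a + n) / suc n                ≤⟨ /-monoˡ-≤ (suc n) (+-monoʳ-≤ a (n≤1+n n)) ⟩
  (a + suc n) / suc n            ≡⟨ m/n≡1+[m∸n]/n (m≤n+m (suc n) a) ⟩
  suc ((a + suc n ∸ suc n) / suc n)  ≡⟨ cong (λ b → suc (b / suc n)) (m+n∸n≡m a (suc n)) ⟩
  suc (a / suc n)                ∎)
  where open ≤-Reasoning

FloorOrCeil⇒≡⊎≡1+ : ∀ a n {x} → FloorOrCeil a n x → x ≡ ⌊ a / n ⌋ ⊎ x ≡ suc ⌊ a / n ⌋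
FloorOrCeil⇒≡⊎≡1+ a n (inj₁ x≡⌊⌋) = inj₁ x≡⌊⌋
FloorOrCeil⇒≡⊎≡1+ a n (inj₂ refl) = ⌈/⌉≡⌊/⌋⊎⌈/⌉≡1+⌊/⌋ a n

⌊/⌋-unique : ∀ {a n q} → q * n ≤ a → a < suc q * n → ⌊ a / n ⌋ ≡ q
⌊/⌋-unique {a} {zero} {q} _ a<0 = contradiction (subst (a <_) (*-zeroʳ (suc q)) a<0) λ ()
⌊/⌋-unique {a} {suc n} {q} q*n≤a a<[1+q]*n = ≤-antisym
  (≤-pred (m<n*o⇒m/o<n a<[1+q]*n))
  (subst (_≤ a / suc n) (m*n/n≡m q (suc n)) (/-monoˡ-≤ (suc n) q*n≤a))

-- For a near triple array: e = ⌊rc/v⌋, Q = Σₓ rep(x)², m = ⌊λcc⌋, and `frobenius`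
-- is the trace comparison 2m(cr² − Q) ≤ m(m + 1)(v² + c − c² − v) without subtraction.
record ArrayInvariants (r c v : ℕ) : Set where
  field
    e Q m               : ℕ
    e≡⌊rc/v⌋            : e ≡ ⌊ r * c / v ⌋
    replication         : Q + v * (e * suc e) ≡ suc (2 * e) * (c * r)
    intersections-lower : c * (c * m) + c * r ≤ Q + c * m
    intersections-upper : Q + c * suc m ≤ c * (c * suc m) + c * r
    frobenius           : m * (2 * (c * (r * r)) + suc m * (c * c + v)) ≤ m * (2 * Q + suc m * (v * v + c))

invariants : ∀ {r c v} → NearTripleArray r c v → ArrayInvariants r c v
invariants {r} {c} {v} (A , (_ , col-binary) , equireplicate , _ , _ , colCol-floorOrCeil) = record
  { e = e ; Q = ∑R² ; m = m ; e≡⌊rc/v⌋ = refl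
  ; replication         = ∑R²-replication e R-two-valued
  ; intersections-lower = intersections-lower m gram-N-two-valued
  ; intersections-upper = intersections-upper m gram-N-two-valued
  ; frobenius           = frobenius m gram-N-two-valued
  }
  where
  open Incidence A col-binary

  e m : ℕ
  e = ⌊ r * c / v ⌋
  m = ⌊ Scc A / c C 2 ⌋

  R-two-valued : ∀ x → R x ≡ e ⊎ R x ≡ suc e
  R-two-valued x = subst (λ y → y ≡ e ⊎ y ≡ suc e) (rep≡R x) (rep-two-valued equireplicate)
    where
    rep-two-valued : EquiOrNearEqui A → rep A x ≡ e ⊎ rep A x ≡ suc e
    rep-two-valued (inj₁ (_ , equi)) = inj₁ (equi x)
    rep-two-valued (inj₂ (_ , near)) = FloorOrCeil⇒≡⊎≡1+ (r * c) v (near x)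

  gram-N-two-valued-< : ∀ j j′ → toℕ j < toℕ j′ → gram N j j′ ≡ m ⊎ gram N j j′ ≡ suc m
  gram-N-two-valued-< j j′ j<j′ = subst (λ y → y ≡ m ⊎ y ≡ suc m) (colCol≡gram j j′)
                                        (FloorOrCeil⇒≡⊎≡1+ (Scc A) (c C 2) (colCol-floorOrCeil j j′ j<j′))

  gram-N-two-valued : ∀ j j′ → j′ ≢ j → gram N j j′ ≡ m ⊎ gram N j j′ ≡ suc m
  gram-N-two-valued j j′ j′≢j with <-cmp (toℕ j) (toℕ j′)
  ... | tri< j<j′ _ _ = gram-N-two-valued-< j j′ j<j′
  ... | tri≈ _ j≡j′ _ = contradiction (toℕ-injective (sym j≡j′)) j′≢j
  ... | tri> _ _ j′<j = subst (λ y → y ≡ m ⊎ y ≡ suc m) (gram-sym N j′ j) (gram-N-two-valued-< j′ j j′<j)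

c[c∸1]-mono-≤ : ∀ c {a b} → a ≤ b → c * (c * a) + c * b ≤ c * (c * b) + c * a
c[c∸1]-mono-≤ c {a} a≤b with m≤n⇒∃[o]m+o≡n a≤b
... | d , refl = begin
  c * (c * a) + c * (a + d)          ≡⟨ solve (c ∷ a ∷ d ∷ []) ⟩
  c * (c * a) + c * a + c * d        ≤⟨ +-monoʳ-≤ (c * (c * a) + c * a) (c*d≤c*[c*d] c) ⟩
  c * (c * a) + c * a + c * (c * d)  ≡⟨ solve (c ∷ a ∷ d ∷ []) ⟩
  c * (c * (a + d)) + c * a          ∎
  where
  open ≤-Reasoning
  c*d≤c*[c*d] : ∀ c → c * d ≤ c * (c * d)
  c*d≤c*[c*d] zero        = z≤n
  c*d≤c*[c*d] c@(suc _)   = m≤n*m (c * d) c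

counts⇒m≤M : ∀ {c r Q m M} → c * (c * m) + c * r ≤ Q + c * m → Q + c * suc M < c * (c * suc M) + c * r → m ≤ M
counts⇒m≤M {c} {r} {Q} {m} {M} lower few with m ≤? M
... | yes m≤M = m≤M
... | no  m≰M = contradiction (+-cancelʳ-≤ (c * m) _ _ (begin
  c * (c * suc M) + c * r + c * m   ≡⟨ xy∙z≈xz∙y (c * (c * suc M)) _ _ ⟩
  c * (c * suc M) + c * m + c * r   ≤⟨ +-monoˡ-≤ (c * r) (c[c∸1]-mono-≤ c (≰⇒> m≰M)) ⟩
  c * (c * m) + c * suc M + c * r   ≡⟨ xy∙z≈xz∙y (c * (c * m)) _ _ ⟩
  c * (c * m) + c * r + c * suc M   ≤⟨ +-monoˡ-≤ (c * suc M) lower ⟩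
  Q + c * m + c * suc M             ≡⟨ xy∙z≈xz∙y Q _ _ ⟩
  Q + c * suc M + c * m             ∎)) (<⇒≱ few)
  where open ≤-Reasoning

counts⇒1≤m : ∀ {c r Q m} → Q + c * suc m ≤ c * (c * suc m) + c * r → c * c + c * r < Q + c → 1 ≤ m
counts⇒1≤m {m = suc _} _ _ = s≤s z≤n
counts⇒1≤m {c} {r} {Q} {zero} upper many =
  contradiction (subst₂ (λ a b → Q + a ≤ c * b + c * r) (*-identityʳ c) (*-identityʳ c) upper) (<⇒≱ many)

frobenius-bound : ∀ {c v r Q m D} → 1 ≤ m →
  m * (2 * (c * (r * r)) + suc m * (c * c + v)) ≤ m * (2 * Q + suc m * (v * v + c)) →
  v * v + c ≡ c * c + v + D → 2 * (c * (r * r)) ≤ 2 * Q + suc m * D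
frobenius-bound {c} {v} {r} {Q} {suc m} {D} _ frobenius defect = +-cancelʳ-≤ (suc (suc m) * (c * c + v)) _ _ (begin
  2 * (c * (r * r)) + suc (suc m) * (c * c + v)  ≤⟨ *-cancelˡ-≤ (suc m) frobenius ⟩
  2 * Q + suc (suc m) * (v * v + c)              ≡⟨ cong (λ y → 2 * Q + suc (suc m) * y) defect ⟩
  2 * Q + suc (suc m) * (c * c + v + D)          ≡⟨ solve (c ∷ v ∷ Q ∷ m ∷ D ∷ []) ⟩
  2 * Q + suc (suc m) * D + suc (suc m) * (c * c + v)  ∎)
  where open ≤-Reasoning

-- The floor bounds pin down e and hence Q; the intersection counts squeeze m into
-- [1, M]; `gap` then contradicts the consequence 2cr² ≤ 2Q + (m + 1)D of `frobenius`.
record InfeasibilityCertificate (r c v : ℕ) : Set where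
  field
    e Q M D     : ℕ
    floor-lower : e * v ≤ r * c
    floor-upper : r * c < suc e * v
    replication : Q + v * (e * suc e) ≡ suc (2 * e) * (c * r)
    forces-m≤M  : Q + c * suc M < c * (c * suc M) + c * r
    forces-1≤m  : c * c + c * r < Q + c
    defect      : v * v + c ≡ c * c + v + D
    gap         : 2 * Q + suc M * D < 2 * (c * (r * r))

certificate⇒¬array : ∀ {r c v} → InfeasibilityCertificate r c v → ¬ NearTripleArray r c v
certificate⇒¬array {r} {c} {v} cert array = <⇒≱ gap (begin
  2 * (c * (r * r))      ≤⟨ frobenius-bound {c} {v} {r} {I.Q} {I.m} {D} 1≤m I.frobenius defect ⟩
  2 * I.Q + suc I.m * D  ≡⟨ cong (λ q → 2 * q + suc I.m * D) Q≡ ⟩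
  2 * Q + suc I.m * D    ≤⟨ +-monoʳ-≤ (2 * Q) (*-monoˡ-≤ D (s≤s m≤M)) ⟩
  2 * Q + suc M * D      ∎)
  where
  open ≤-Reasoning
  open InfeasibilityCertificate cert
  module I = ArrayInvariants (invariants array)

  e≡ : I.e ≡ e
  e≡ = trans I.e≡⌊rc/v⌋ (⌊/⌋-unique floor-lower floor-upper)

  Q≡ : I.Q ≡ Q
  Q≡ = +-cancelʳ-≡ (v * (e * suc e)) I.Q Q
         (trans (subst (λ x → I.Q + v * (x * suc x) ≡ suc (2 * x) * (c * r)) e≡ I.replication) (sym replication))

  m≤M : I.m ≤ M
  m≤M = counts⇒m≤M {c} {r} {I.Q} I.intersections-lower (subst (λ q → q + c * suc M < c * (c * suc M) + c * r) (sym Q≡) forces-m≤M)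

  1≤m : 1 ≤ I.m
  1≤m = counts⇒1≤m {c} {r} {I.Q} I.intersections-upper (subst (λ q → c * c + c * r < q + c) (sym Q≡) forces-1≤m)

¬array-resp : ∀ {r c v r′ c′ v′} → r ≡ r′ → c ≡ c′ → v ≡ v′ → ¬ NearTripleArray r′ c′ v′ → ¬ NearTripleArray r c v
¬array-resp refl refl refl ¬array = ¬array

m≡n+o⇒m∸n≡o : ∀ m n {o} → m ≡ n + o → m ∸ n ≡ o
m≡n+o⇒m∸n≡o m n {o} m≡n+o = trans (cong (_∸ n) m≡n+o) (m+n∸m≡n n o)

-- Cases (a) and (b) with k = 3 + t: rc = ev + ρ with e = 2k − 2, so Q = ve² + (2e + 1)ρ.
certificate-a : ∀ t → InfeasibilityCertificate (5 + 2 * t) (9 + 4 * t) (11 + 4 * t)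
certificate-a t = record
  { e = 4 + 2 * t
  ; Q = (11 + 4 * t) * ((4 + 2 * t) * (4 + 2 * t)) + (9 + 4 * t)
  ; M = 1 + t
  ; D = 38 + 16 * t
  ; floor-lower = m+k≡n⇒m≤n 1 (solve (t ∷ []))
  ; floor-upper = m+k≡n⇒m≤n (9 + 4 * t) (solve (t ∷ []))
  ; replication = solve (t ∷ [])
  ; forces-m≤M  = m+k≡n⇒m≤n (3 + 2 * t) (solve (t ∷ []))
  ; forces-1≤m  = m+k≡n⇒m≤n (67 + 138 * t + 84 * t * t + 16 * t * t * t) (solve (t ∷ []))
  ; defect      = solve (t ∷ [])
  ; gap         = m+k≡n⇒m≤n (3 + 2 * t) (solve (t ∷ []))
  }

certificate-b : ∀ t → InfeasibilityCertificate (6 + 2 * t) (9 + 4 * t) (11 + 4 * t)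
certificate-b t = record
  { e = 4 + 2 * t
  ; Q = (11 + 4 * t) * ((4 + 2 * t) * (4 + 2 * t)) + (9 + 4 * t) * (10 + 4 * t)
  ; M = 2 + t
  ; D = 38 + 16 * t
  ; floor-lower = m+k≡n⇒m≤n (10 + 4 * t) (solve (t ∷ []))
  ; floor-upper = m+k≡n⇒m≤n 0 (solve (t ∷ []))
  ; replication = solve (t ∷ [])
  ; forces-m≤M  = m+k≡n⇒m≤n (3 + 2 * t) (solve (t ∷ []))
  ; forces-1≤m  = m+k≡n⇒m≤n (139 + 206 * t + 100 * t * t + 16 * t * t * t) (solve (t ∷ []))
  ; defect      = solve (t ∷ [])
  ; gap         = m+k≡n⇒m≤n (1 + 2 * t) (solve (t ∷ []))
  }

part-a : ∀ k → 3 ≤ k → ¬ NearTripleArray (2 * k ∸ 1) (4 * k ∸ 3) (4 * k ∸ 1)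
part-a k 3≤k with m≤n⇒∃[o]m+o≡n 3≤k
... | t , refl = ¬array-resp r≡ c≡ v≡ (certificate⇒¬array (certificate-a t))
  where
  r≡ : 2 * (3 + t) ∸ 1 ≡ 5 + 2 * t
  r≡ = m≡n+o⇒m∸n≡o (2 * (3 + t)) 1 (solve (t ∷ []))
  c≡ : 4 * (3 + t) ∸ 3 ≡ 9 + 4 * t
  c≡ = m≡n+o⇒m∸n≡o (4 * (3 + t)) 3 (solve (t ∷ []))
  v≡ : 4 * (3 + t) ∸ 1 ≡ 11 + 4 * t
  v≡ = m≡n+o⇒m∸n≡o (4 * (3 + t)) 1 (solve (t ∷ []))

part-b : ∀ k → 3 ≤ k → ¬ NearTripleArray (2 * k) (4 * k ∸ 3) (4 * k ∸ 1)
part-b k 3≤k with m≤n⇒∃[o]m+o≡n 3≤k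
... | t , refl = ¬array-resp r≡ c≡ v≡ (certificate⇒¬array (certificate-b t))
  where
  r≡ : 2 * (3 + t) ≡ 6 + 2 * t
  r≡ = solve (t ∷ [])
  c≡ : 4 * (3 + t) ∸ 3 ≡ 9 + 4 * t
  c≡ = m≡n+o⇒m∸n≡o (4 * (3 + t)) 3 (solve (t ∷ []))
  v≡ : 4 * (3 + t) ∸ 1 ≡ 11 + 4 * t
  v≡ = m≡n+o⇒m∸n≡o (4 * (3 + t)) 1 (solve (t ∷ []))

n*[1+n]≡2*[1+n]C2 : ∀ n → n * suc n ≡ 2 * (suc n C 2)
n*[1+n]≡2*[1+n]C2 zero    = refl
n*[1+n]≡2*[1+n]C2 (suc n) = begin
  suc n * suc (suc n)                ≡⟨ solve (n ∷ []) ⟩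
  2 * suc n + n * suc n              ≡⟨ cong₂ _+_ (cong (2 *_) (sym (nC1≡n (suc n)))) (n*[1+n]≡2*[1+n]C2 n) ⟩
  2 * (suc n C 1) + 2 * (suc n C 2)  ≡⟨ *-distribˡ-+ 2 (suc n C 1) (suc n C 2) ⟨
  2 * (suc n C 1 + suc n C 2)        ≡⟨ cong (2 *_) (nCk+nC[k+1]≡[n+1]C[k+1] (suc n) 1) ⟩
  2 * (suc (suc n) C 2)              ∎
  where open ≡-Reasoning

small-s⇒2+2s≤E : ∀ {E s} → 1 ≤ s → 2 * suc E * s ≤ E * (E ∸ 1) → 2 + 2 * s ≤ E
small-s⇒2+2s≤E {E} {s@(suc s′)} _ small with 2 + 2 * s ≤? E
... | yes E≥ = E≥
... | no  E≱ = contradiction small (<⇒≱ (begin-strict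
  E * (E ∸ 1)      ≤⟨ *-monoʳ-≤ E (∸-monoˡ-≤ 1 (≤-pred (≰⇒> E≱))) ⟩
  E * (2 * s)      <⟨ *-monoˡ-< (2 * s) (n<1+n E) ⟩
  suc E * (2 * s)  ≡⟨ solve (E ∷ s′ ∷ []) ⟩
  2 * suc E * s    ∎))
  where open ≤-Reasoning

0<2*[s*[1+s]] : ∀ {s} → 1 ≤ s → 0 < 2 * (s * suc s)
0<2*[s*[1+s]] (s≤s z≤n) = s≤s z≤n

-- Case (c) with k = E + 1, N = k(k − 1)/2 = c + s and c = 2 + 2s + f.  Then
-- ⌊rc/v⌋ = E, the replication numbers force Q = 2N(c − s − 1) + ck, and the
-- intersection counts force m = 1.
module CaseC {E s f : ℕ} (1≤s : 1 ≤ s) (E≥ : 2 + 2 * s ≤ E) (E[1+E]≡2N : E * suc E ≡ 2 * (2 + 2 * s + f + s)) where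

  E*[1+s]<c : E * suc s < 2 + 2 * s + f
  E*[1+s]<c = +-cancelʳ-≤ s _ _ (*-cancelˡ-≤ 2 (begin
    2 * (suc (E * suc s) + s)       ≡⟨ solve (E ∷ s ∷ []) ⟩
    E * (2 + 2 * s) + (2 + 2 * s)   ≤⟨ +-monoʳ-≤ (E * (2 + 2 * s)) E≥ ⟩
    E * (2 + 2 * s) + E             ≡⟨ solve (E ∷ s ∷ []) ⟩
    E * suc (2 + 2 * s)             ≤⟨ *-monoʳ-≤ E (s≤s E≥) ⟩
    E * suc E                       ≡⟨ E[1+E]≡2N ⟩
    2 * (2 + 2 * s + f + s)         ∎))
    where open ≤-Reasoning

  floor-lower : E * (2 + 2 * s + f + s + 1) ≤ suc E * (2 + 2 * s + f)
  floor-lower = begin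
    E * (2 + 2 * s + f + s + 1)            ≡⟨ solve (E ∷ s ∷ f ∷ []) ⟩
    E * (2 + 2 * s + f) + E * suc s        ≤⟨ +-monoʳ-≤ (E * (2 + 2 * s + f)) (<⇒≤ E*[1+s]<c) ⟩
    E * (2 + 2 * s + f) + (2 + 2 * s + f)  ≡⟨ solve (E ∷ s ∷ f ∷ []) ⟩
    suc E * (2 + 2 * s + f)                ∎
    where open ≤-Reasoning

  replication : 2 * (2 + 2 * s + f + s) * (1 + s + f) + (2 + 2 * s + f) * suc E + (2 + 2 * s + f + s + 1) * (E * suc E)
              ≡ suc (2 * E) * ((2 + 2 * s + f) * suc E)
  replication = begin
    2 * (2 + 2 * s + f + s) * (1 + s + f) + (2 + 2 * s + f) * suc E + (2 + 2 * s + f + s + 1) * (E * suc E)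
      ≡⟨ cong (λ z → 2 * (2 + 2 * s + f + s) * (1 + s + f) + (2 + 2 * s + f) * suc E + (2 + 2 * s + f + s + 1) * z) E[1+E]≡2N ⟩
    2 * (2 + 2 * s + f + s) * (1 + s + f) + (2 + 2 * s + f) * suc E + (2 + 2 * s + f + s + 1) * (2 * (2 + 2 * s + f + s))
      ≡⟨ solve (E ∷ s ∷ f ∷ []) ⟩
    2 * (2 + 2 * s + f) * (2 * (2 + 2 * s + f + s)) + (2 + 2 * s + f) * suc E
      ≡⟨ cong (λ z → 2 * (2 + 2 * s + f) * z + (2 + 2 * s + f) * suc E) E[1+E]≡2N ⟨
    2 * (2 + 2 * s + f) * (E * suc E) + (2 + 2 * s + f) * suc E
      ≡⟨ solve (E ∷ s ∷ f ∷ []) ⟩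
    suc (2 * E) * ((2 + 2 * s + f) * suc E)
      ∎
    where open ≡-Reasoning

  m≤1-identity : 2 * (2 + 2 * s + f + s) * (1 + s + f) + (2 + 2 * s + f) * suc E + (2 + 2 * s + f) * 2 + 2 * (s * suc s)
               ≡ (2 + 2 * s + f) * ((2 + 2 * s + f) * 2) + (2 + 2 * s + f) * suc E
  m≤1-identity = solve (E ∷ s ∷ f ∷ [])

  gap-identity : 2 * (2 * (2 + 2 * s + f + s) * (1 + s + f) + (2 + 2 * s + f) * suc E)
                   + 2 * (suc s * (2 * (2 + 2 * s + f) + s)) + 2 * (s * suc s)
               ≡ 2 * ((2 + 2 * s + f) * (suc E * suc E))
  gap-identity = begin
    2 * (2 * (2 + 2 * s + f + s) * (1 + s + f) + (2 + 2 * s + f) * suc E)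
      + 2 * (suc s * (2 * (2 + 2 * s + f) + s)) + 2 * (s * suc s)
      ≡⟨ solve (E ∷ s ∷ f ∷ []) ⟩
    2 * ((2 + 2 * s + f) * (suc E + 2 * (2 + 2 * s + f + s)))
      ≡⟨ cong (λ z → 2 * ((2 + 2 * s + f) * (suc E + z))) E[1+E]≡2N ⟨
    2 * ((2 + 2 * s + f) * (suc E * suc E))
      ∎
    where open ≡-Reasoning

  certificate : InfeasibilityCertificate (suc E) (2 + 2 * s + f) (2 + 2 * s + f + s + 1)
  certificate = record
    { e = E
    ; Q = 2 * (2 + 2 * s + f + s) * (1 + s + f) + (2 + 2 * s + f) * suc E
    ; M = 1
    ; D = suc s * (2 * (2 + 2 * s + f) + s)
    ; floor-lower = floor-lower
    ; floor-upper = m+k≡n⇒m≤n (E * suc s + s) (solve (E ∷ s ∷ f ∷ []))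
    ; replication = replication
    ; forces-m≤M  = m+k≡n⇒m<n (2 * (s * suc s)) (0<2*[s*[1+s]] 1≤s) m≤1-identity
    ; forces-1≤m  = m+k≡n⇒m≤n (1 + 3 * f + 4 * s + 4 * f * s + f * f + 2 * s * s) (solve (E ∷ s ∷ f ∷ []))
    ; defect      = solve (s ∷ f ∷ [])
    ; gap         = m+k≡n⇒m<n (2 * (s * suc s)) (0<2*[s*[1+s]] 1≤s) gap-identity
    }

part-c : ∀ k s → 1 ≤ k → 1 ≤ s → 2 * k * s ≤ (k ∸ 1) * (k ∸ 2) → ¬ NearTripleArray k (k C 2 ∸ s) (k C 2 + 1)
part-c (suc E) s _ 1≤s small =
  ¬array-resp refl c≡ v≡ (certificate⇒¬array (CaseC.certificate 1≤s E≥ E[1+E]≡2[c+s]))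
  where
  open ≤-Reasoning

  N f : ℕ
  N = suc E C 2

  E≥ : 2 + 2 * s ≤ E
  E≥ = small-s⇒2+2s≤E 1≤s small

  N≥ : 2 + 2 * s + s ≤ N
  N≥ = *-cancelˡ-≤ 2 (begin
    2 * (2 + 2 * s + s)         ≤⟨ m+k≡n⇒m≤n (2 + 4 * s + 4 * s * s) (solve (s ∷ [])) ⟩
    (2 + 2 * s) * (3 + 2 * s)   ≤⟨ *-mono-≤ E≥ (s≤s E≥) ⟩
    E * suc E                   ≡⟨ n*[1+n]≡2*[1+n]C2 E ⟩
    2 * N                       ∎)
  f = N ∸ (2 + 2 * s + s)

  N≡ : N ≡ 2 + 2 * s + f + s
  N≡ = trans (sym (m+[n∸m]≡n N≥)) (xy∙z≈xz∙y (2 + 2 * s) s f)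

  c≡ : N ∸ s ≡ 2 + 2 * s + f
  c≡ = trans (cong (_∸ s) N≡) (m+n∸n≡m (2 + 2 * s + f) s)

  v≡ : N + 1 ≡ 2 + 2 * s + f + s + 1
  v≡ = cong (_+ 1) N≡

  E[1+E]≡2[c+s] : E * suc E ≡ 2 * (2 + 2 * s + f + s)
  E[1+E]≡2[c+s] = trans (n*[1+n]≡2*[1+n]C2 E) (cong (2 *_) N≡)

corollary6p3 :
    (∀ (k : ℕ) → 3 ≤ k → ¬ NearTripleArray (2 * k ∸ 1) (4 * k ∸ 3) (4 * k ∸ 1))
    × (∀ (k : ℕ) → 3 ≤ k → ¬ NearTripleArray (2 * k) (4 * k ∸ 3) (4 * k ∸ 1))
    × (∀ (k s : ℕ) → 1 ≤ k → 1 ≤ s → 2 * k * s ≤ (k ∸ 1) * (k ∸ 2)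
        → ¬ NearTripleArray k (k C 2 ∸ s) (k C 2 + 1))
corollary6p3 = part-a , part-b , part-c
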